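{- Let $p(\lambda)=\lambda^n-a_1\lambda^{n-1}+a_2\lambda^{n-2}-\cdots+(-1)^n a_n$ be a polynomial of degree $n$ whose $n$ roots $\lambda_1,\ldots,\lambda_n$ are positive integers, and suppose $\bar\lambda=(\lambda_1+\cdots+\lambda_n)/n$ is not an integer. Let $\lambda_*=\lfloor\bar\lambda\rfloor$, $\lambda^*=\lceil\bar\lambda\rceil$, and let $\delta$ be the positive integer with $n\bar\lambda=(n-\delta)\lambda^*+\delta\lambda_*$. Then for each $m$, $a_m$ is at most the value of the elementary symmetric function $e_m$ of degree $m$ in $n$ variables evaluated with $n-\delta$ variables equal to $\lambda^*$ and $\delta$ variables equal to $\lambda_*$. In particular, $$a_2\le\binom{n-\delta}{2}(\lambda^*)^2+(n-\delta)\delta\,\lambda^*\lambda_*+\binom{\delta}{2}\lambda_*^2,$$ and equality occurs if and only if $p(\lambda)=(\lambda-\lambda^*)^{n-\delta}(\lambda-\lambda_*)^{\delta}$.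
   Context: $e_m(x_1,\ldots,x_n)=\sum_{1\le i_1<\cdots<i_m\le n}x_{i_1}\cdots x_{i_m}$. -}

module Defs where

open import Data.Nat as ℕ using (ℕ; zero; suc; _+_; _*_; _∸_; NonZero)
open import Data.Nat.DivMod using (_/_)
open import Data.Integer as ℤ using (ℤ; -_; +_)
open import Data.List using (List; []; _∷_; replicate; _++_; map)

e : ℕ → List ℕ → ℕ
e zero    _        = 1
e (suc m) []       = 0
e (suc m) (x ∷ xs) = x * e m xs + e (suc m) xs

-- Polynomials over ℤ as coefficient lists, lowest degree first.
addHead : ℤ → List ℤ → List ℤ
addHead c []       = c ∷ []
addHead c (d ∷ ds) = (c ℤ.+ d) ∷ ds

-- multiply a polynomial by (X - r):  (X - r)(c + X·Q) = -rc + X(c + (X - r)Q)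
mulLin : ℤ → List ℤ → List ℤ
mulLin r []       = []
mulLin r (c ∷ cs) = (- (r ℤ.* c)) ∷ addHead c (mulLin r cs)

polyFromRoots : List ℕ → List ℤ
polyFromRoots []       = + 1 ∷ []
polyFromRoots (r ∷ rs) = mulLin (+ r) (polyFromRoots rs)

floorDiv : (s n : ℕ) → .{{NonZero n}} → ℕ
floorDiv s n = s / n

ceilDiv : (s n : ℕ) → .{{NonZero n}} → ℕ
ceilDiv s n = (s + (n ∸ 1)) / n

extremal : (n δ hi lo : ℕ) → List ℕ
extremal n δ hi lo = replicate (n ∸ δ) hi ++ replicate δ lo

-- Expanding e_m (a ∷ b ∷ R) = a b e_{m-2} R + (a + b) e_{m-1} R + e_m R shows that moving one
-- unit from an entry a to an entry b ≤ a - 2 keeps the length and the sum and raises every e_m,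
-- e_2 strictly. Inserting the entries one at a time into a list whose entries differ by at most
-- one, such moves show that every list is dominated in all e_m by the balanced list with the same
-- length and sum, and in e_2 strictly unless it is a permutation of it. Because n ∤ Σ λᵢ we have
-- λ^* = λ_* + 1, so the extremal multiset is that balanced list. Conversely e_2 can be read off
-- the polynomial as its third-highest coefficient.

module Submission where

open import Defs
open import Data.Nat using (ℕ; zero; suc; _+_; _*_; _∸_; _^_; _≤_; _<_; s≤s; z≤n; NonZero)
open import Data.Nat.Properties
open import Data.Nat.Divisibility using (_∣_; 1∣_; n∣m*n; m%n≡0⇒n∣m)
open import Data.Nat.DivMod
  using (_/_; _%_; m≡m%n+[m/n]*n; m%n<n; m<n⇒m/n≡0; m*n/n≡m; +-distrib-/-∣ʳ; m≥n⇒m/n>0)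
open import Data.Nat.Combinatorics using (_C_; nC1≡n; nCk+nC[k+1]≡[n+1]C[k+1])
import Data.Nat.ListAction as List
open import Data.Nat.ListAction.Properties using (sum-↭; sum-++)
open import Data.Nat.Tactic.RingSolver renaming (solve-∀ to ℕ-solve-∀)
open import Data.Integer as ℤ using (ℤ; -_; +_; _-_; 1ℤ)
import Data.Integer.Properties as ℤ
open import Data.Integer.Tactic.RingSolver using (solve-∀)
open import Data.List using (List; []; _∷_; length; replicate; _++_; reverse)
open import Data.List.Properties
  using (++-identityʳ; length-++; length-replicate; reverse-++; ∷-injective)
open import Data.List.Relation.Binary.Permutation.Propositional
  using (_↭_; refl; prep; swap; trans; ↭-sym)
open import Data.List.Relation.Binary.Permutation.Propositional.Properties
  using (↭-length; shift; ++-comm; All-resp-↭)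
import Data.List.Relation.Unary.All as List
open import Data.List.Relation.Unary.All.Properties using (++⁺; ++⁻ʳ; replicate⁺)
open import Data.Vec using (Vec; []; _∷_; toList; sum)
open import Data.Vec.Properties using (length-toList)
open import Data.Vec.Relation.Unary.All using (All; []; _∷_)
open import Data.Product using (_×_; _,_; proj₁; proj₂; ∃-syntax; ∃₂)
open import Data.Sum using (_⊎_; inj₁; inj₂)
open import Function.Bundles using (_⇔_; mk⇔)
open import Relation.Binary using (tri<; tri≈; tri>)
open import Relation.Binary.PropositionalEquality as ≡ using (_≡_; cong; cong₂)
open import Relation.Nullary using (¬_; contradiction)

e-∷-cong : ∀ x {xs ys} → (∀ m → e m xs ≡ e m ys) → ∀ m → e m (x ∷ xs) ≡ e m (x ∷ ys)
e-∷-cong x eq zero    = ≡.refl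
e-∷-cong x eq (suc m) = cong₂ (λ a b → x * a + b) (eq m) (eq (suc m))

e-∷-mono : ∀ x {xs ys} → (∀ m → e m xs ≤ e m ys) → ∀ m → e m (x ∷ xs) ≤ e m (x ∷ ys)
e-∷-mono x le zero    = ≤-refl
e-∷-mono x le (suc m) = +-mono-≤ (*-monoʳ-≤ x (le m)) (le (suc m))

e-swap : ∀ m x y xs → e m (x ∷ y ∷ xs) ≡ e m (y ∷ x ∷ xs)
e-swap zero          x y xs = ≡.refl
e-swap (suc zero)    x y xs = lemma x y (e 1 xs)
  where lemma : ∀ x y a → x * 1 + (y * 1 + a) ≡ y * 1 + (x * 1 + a)
        lemma = ℕ-solve-∀
e-swap (suc (suc m)) x y xs = lemma x y (e m xs) (e (suc m) xs) (e (suc (suc m)) xs)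
  where lemma : ∀ x y a b c → x * (y * a + b) + (y * b + c) ≡ y * (x * a + b) + (x * b + c)
        lemma = ℕ-solve-∀

e-↭ : ∀ {xs ys} → xs ↭ ys → ∀ m → e m xs ≡ e m ys
e-↭ refl                    m = ≡.refl
e-↭ (prep x p)                = e-∷-cong x (e-↭ p)
e-↭ (swap {xs} x y p)       m = ≡.trans (e-swap m x y xs) (e-∷-cong y (e-∷-cong x (e-↭ p)) m)
e-↭ (trans p q)             m = ≡.trans (e-↭ p m) (e-↭ q m)

e₁≡sum : ∀ xs → e 1 xs ≡ List.sum xs
e₁≡sum []       = ≡.refl
e₁≡sum (x ∷ xs) = cong₂ _+_ (*-identityʳ x) (e₁≡sum xs)

e-pair : ∀ m a b R → e (2 + m) (a ∷ b ∷ R) ≡ a * b * e m R + (a + b) * e (1 + m) R + e (2 + m) R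
e-pair m a b R = lemma a b (e m R) (e (1 + m) R) (e (2 + m) R)
  where lemma : ∀ a b x y z → a * (b * x + y) + (b * y + z) ≡ a * b * x + (a + b) * y + z
        lemma = ℕ-solve-∀

e-zeros-++ : ∀ p m xs → e m (replicate p 0 ++ xs) ≡ e m xs
e-zeros-++ zero    m       xs = ≡.refl
e-zeros-++ (suc p) zero    xs = ≡.refl
e-zeros-++ (suc p) (suc m) xs = e-zeros-++ p (suc m) xs

e-++-zeros : ∀ xs p m → e m (xs ++ replicate p 0) ≡ e m xs
e-++-zeros xs p m = ≡.trans (e-↭ (++-comm xs (replicate p 0)) m) (e-zeros-++ p m xs)

record _≼_ (xs ys : List ℕ) : Set where
  field
    length-≡ : length xs ≡ length ys
    sum-≡    : List.sum xs ≡ List.sum ys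
    e-≤      : ∀ m → e m xs ≤ e m ys
    ↭⊎e₂<    : xs ↭ ys ⊎ e 2 xs < e 2 ys

open _≼_

↭⇒≼ : ∀ {xs ys} → xs ↭ ys → xs ≼ ys
↭⇒≼ p = record
  { length-≡ = ↭-length p
  ; sum-≡    = sum-↭ p
  ; e-≤      = λ m → ≤-reflexive (e-↭ p m)
  ; ↭⊎e₂<    = inj₁ p
  }

≼-refl : ∀ {xs} → xs ≼ xs
≼-refl = ↭⇒≼ refl

≼-trans : ∀ {xs ys zs} → xs ≼ ys → ys ≼ zs → xs ≼ zs
≼-trans {xs} {ys} {zs} p q = record
  { length-≡ = ≡.trans (length-≡ p) (length-≡ q)
  ; sum-≡    = ≡.trans (sum-≡ p) (sum-≡ q)
  ; e-≤      = λ m → ≤-trans (e-≤ p m) (e-≤ q m)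
  ; ↭⊎e₂<    = strict (↭⊎e₂< p) (↭⊎e₂< q)
  }
  where
  strict : xs ↭ ys ⊎ e 2 xs < e 2 ys → ys ↭ zs ⊎ e 2 ys < e 2 zs → xs ↭ zs ⊎ e 2 xs < e 2 zs
  strict (inj₁ p) (inj₁ q) = inj₁ (trans p q)
  strict (inj₁ p) (inj₂ q) = inj₂ (≤-<-trans (≤-reflexive (e-↭ p 2)) q)
  strict (inj₂ p) (inj₁ q) = inj₂ (<-≤-trans p (≤-reflexive (e-↭ q 2)))
  strict (inj₂ p) (inj₂ q) = inj₂ (<-trans p q)

∷-mono-≼ : ∀ x {xs ys} → xs ≼ ys → (x ∷ xs) ≼ (x ∷ ys)
∷-mono-≼ x {xs} {ys} p = record
  { length-≡ = cong suc (length-≡ p)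
  ; sum-≡    = cong (_+_ x) (sum-≡ p)
  ; e-≤      = e-∷-mono x (e-≤ p)
  ; ↭⊎e₂<    = strict (↭⊎e₂< p)
  }
  where
  strict : xs ↭ ys ⊎ e 2 xs < e 2 ys → (x ∷ xs) ↭ (x ∷ ys) ⊎ e 2 (x ∷ xs) < e 2 (x ∷ ys)
  strict (inj₁ q) = inj₁ (prep x q)
  strict (inj₂ q) = inj₂ (+-mono-≤-< (*-monoʳ-≤ x (e-≤ p 1)) q)

pair-≼ : ∀ {a b a′ b′} R → a + b ≡ a′ + b′ → a * b < a′ * b′ → (a ∷ b ∷ R) ≼ (a′ ∷ b′ ∷ R)
pair-≼ {a} {b} {a′} {b′} R a+b≡ ab< = record
  { length-≡ = ≡.refl
  ; sum-≡    = sum≡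
  ; e-≤      = e≤
  ; ↭⊎e₂<    = inj₂ e₂<
  }
  where
  sum≡ : a + (b + List.sum R) ≡ a′ + (b′ + List.sum R)
  sum≡ = begin
    a + (b + List.sum R)   ≡⟨ +-assoc a b (List.sum R) ⟨
    a + b + List.sum R     ≡⟨ cong (_+ List.sum R) a+b≡ ⟩
    a′ + b′ + List.sum R   ≡⟨ +-assoc a′ b′ (List.sum R) ⟩
    a′ + (b′ + List.sum R) ∎
    where open ≡.≡-Reasoning
  expand : ∀ m → e (2 + m) (a ∷ b ∷ R) ≡ a * b * e m R + (a′ + b′) * e (1 + m) R + e (2 + m) R
  expand m =
    ≡.trans (e-pair m a b R) (cong (λ σ → a * b * e m R + σ * e (1 + m) R + e (2 + m) R) a+b≡)
  e≤ : ∀ m → e m (a ∷ b ∷ R) ≤ e m (a′ ∷ b′ ∷ R)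
  e≤ zero          = ≤-refl
  e≤ (suc zero)    =
    ≤-reflexive (≡.trans (e₁≡sum (a ∷ b ∷ R)) (≡.trans sum≡ (≡.sym (e₁≡sum (a′ ∷ b′ ∷ R)))))
  e≤ (suc (suc m)) = begin
    e (2 + m) (a ∷ b ∷ R)                                   ≡⟨ expand m ⟩
    a * b * e m R + (a′ + b′) * e (1 + m) R + e (2 + m) R
      ≤⟨ +-monoˡ-≤ _ (+-monoˡ-≤ _ (*-monoˡ-≤ (e m R) (<⇒≤ ab<))) ⟩
    a′ * b′ * e m R + (a′ + b′) * e (1 + m) R + e (2 + m) R ≡⟨ e-pair m a′ b′ R ⟨
    e (2 + m) (a′ ∷ b′ ∷ R)                                 ∎
    where open ≤-Reasoning
  e₂< : e 2 (a ∷ b ∷ R) < e 2 (a′ ∷ b′ ∷ R)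
  e₂< = begin-strict
    e 2 (a ∷ b ∷ R)                          ≡⟨ expand 0 ⟩
    a * b * 1 + (a′ + b′) * e 1 R + e 2 R    <⟨ +-monoˡ-< _ (+-monoˡ-< _ (*-monoˡ-< 1 ab<)) ⟩
    a′ * b′ * 1 + (a′ + b′) * e 1 R + e 2 R  ≡⟨ e-pair 0 a′ b′ R ⟨
    e 2 (a′ ∷ b′ ∷ R)                        ∎
    where open ≤-Reasoning

transfer : ∀ t v R → (suc (suc (t + v)) ∷ v ∷ R) ≼ (suc (t + v) ∷ suc v ∷ R)
transfer t v R = pair-≼ R (≡.sym (+-suc (suc (t + v)) v)) product<
  where
  product≡ : ∀ t v → suc (t + v) * suc v ≡ suc t + suc (suc (t + v)) * v
  product≡ = ℕ-solve-∀
  product< : suc (suc (t + v)) * v < suc (t + v) * suc v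
  product< = <-≤-trans (m<n+m _ {suc t} (s≤s z≤n)) (≤-reflexive (≡.sym (product≡ t v)))

balanced : ℕ → ℕ → ℕ → List ℕ
balanced r s q = replicate r (suc q) ++ replicate s q

balanced-shift : ∀ r s q → (q ∷ balanced r s q) ↭ balanced r (suc s) q
balanced-shift r s q = ↭-sym (shift q (replicate r (suc q)) (replicate s q))

balanced-carry : ∀ r q → balanced r 0 q ≡ balanced 0 r (suc q)
balanced-carry r q = ++-identityʳ (replicate r (suc q))

DominatedByBalanced : List ℕ → Set
DominatedByBalanced xs = ∃[ r ] ∃[ s ] ∃[ q ] xs ≼ balanced r s q

≼-dominatedByBalanced : ∀ {xs ys} → xs ≼ ys → DominatedByBalanced ys → DominatedByBalanced xs
≼-dominatedByBalanced p (r , s , q , p′) = r , s , q , ≼-trans p p′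

insert-equal : ∀ q r s → DominatedByBalanced (q ∷ balanced r s q)
insert-equal q r s = r , suc s , q , ↭⇒≼ (balanced-shift r s q)

insert-above : ∀ d q r s → DominatedByBalanced (d + q ∷ balanced r s q)
insert-above zero          q r s       = insert-equal q r s
insert-above (suc zero)    q r s       = suc r , s , q , ≼-refl
insert-above (suc (suc d)) q r (suc s) =
  ≼-dominatedByBalanced move (insert-above (suc d) q (suc r) s)
  where
  move : (suc (suc d) + q ∷ balanced r (suc s) q) ≼ (suc d + q ∷ balanced (suc r) s q)
  move = ≼-trans (↭⇒≼ (prep _ (↭-sym (balanced-shift r s q)))) (transfer d q (balanced r s q))
insert-above (suc (suc d)) q r zero    =
  ≡.subst DominatedByBalanced (cong₂ _∷_ (+-suc (suc d) q) (≡.sym (balanced-carry r q)))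
    (insert-above (suc d) (suc q) 0 r)

insert-below : ∀ d x r s → DominatedByBalanced (x ∷ balanced r s (d + x))
insert-below zero    x r       s = insert-equal x r s
insert-below (suc d) x (suc r) s =
  ≼-dominatedByBalanced move
    (≡.subst (λ q → DominatedByBalanced (suc x ∷ balanced r (suc s) q)) (+-suc d x)
      (insert-below d (suc x) r (suc s)))
  where
  q : ℕ
  q = suc d + x
  move : (x ∷ balanced (suc r) s q) ≼ (suc x ∷ balanced r (suc s) q)
  move = ≼-trans (↭⇒≼ (swap x (suc q) refl))
           (≼-trans (transfer d x (balanced r s q))
             (↭⇒≼ (trans (swap q (suc x) refl) (prep (suc x) (balanced-shift r s q)))))
insert-below (suc d) x zero    s =
  ≡.subst DominatedByBalanced (cong (x ∷_) (balanced-carry s (d + x))) (insert-below d x s 0)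

insert : ∀ x r s q → DominatedByBalanced (x ∷ balanced r s q)
insert x r s q with ≤-total q x
... | inj₁ q≤x = ≡.subst (λ y → DominatedByBalanced (y ∷ balanced r s q)) (m∸n+n≡m q≤x)
                   (insert-above (x ∸ q) q r s)
... | inj₂ x≤q = ≡.subst (λ y → DominatedByBalanced (x ∷ balanced r s y)) (m∸n+n≡m x≤q)
                   (insert-below (q ∸ x) x r s)

dominatedByBalanced : ∀ xs → DominatedByBalanced xs
dominatedByBalanced []       = 0 , 0 , 0 , ≼-refl
dominatedByBalanced (x ∷ xs) with dominatedByBalanced xs
... | r , s , q , p = ≼-dominatedByBalanced (∷-mono-≼ x p) (insert x r s q)

sum-replicate : ∀ n x → List.sum (replicate n x) ≡ n * x
sum-replicate zero    x = ≡.refl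
sum-replicate (suc n) x = cong (_+_ x) (sum-replicate n x)

length-balanced : ∀ r s q → length (balanced r s q) ≡ r + s
length-balanced r s q = ≡.trans (length-++ (replicate r (suc q)))
                          (cong₂ _+_ (length-replicate r) (length-replicate s))

sum-balanced : ∀ r s q → List.sum (balanced r s q) ≡ r * suc q + s * q
sum-balanced r s q = ≡.trans (sum-++ (replicate r (suc q)) (replicate s q))
                       (cong₂ _+_ (sum-replicate r (suc q)) (sum-replicate s q))

r*[1+q]+s*q≡[r+s]*q+r : ∀ r s q → r * suc q + s * q ≡ (r + s) * q + r
r*[1+q]+s*q≡[r+s]*q+r = ℕ-solve-∀

balanced-carry′ : ∀ r t q → r * t ≡ 0 → balanced r 0 q ≡ balanced 0 r (suc (q + t))
balanced-carry′ zero    t       q rt≡0 = ≡.refl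
balanced-carry′ (suc r) zero    q rt≡0 rewrite +-identityʳ q = balanced-carry (suc r) q
balanced-carry′ (suc r) (suc t) q ()

balanced-excess≡0 : ∀ r s q t r′ s′ → r + s ≡ r′ + s′ →
                    r * suc q + s * q ≡ r′ * suc (suc (q + t)) + s′ * suc (q + t) →
                    s + ((r + s) * t + r′) ≡ 0
balanced-excess≡0 r s q t r′ s′ len sum≡ = +-cancelˡ-≡ r _ _ (≡.sym (+-cancelˡ-≡ (k * q) _ _ (begin
  k * q + (r + 0)                                 ≡⟨ cong (_+_ (k * q)) (+-identityʳ r) ⟩
  k * q + r                                       ≡⟨ r*[1+q]+s*q≡[r+s]*q+r r s q ⟨
  r * suc q + s * q                               ≡⟨ sum≡ ⟩
  r′ * suc (suc (q + t)) + s′ * suc (q + t)       ≡⟨ r*[1+q]+s*q≡[r+s]*q+r r′ s′ (suc (q + t)) ⟩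
  (r′ + s′) * suc (q + t) + r′                    ≡⟨ cong (λ k′ → k′ * suc (q + t) + r′) (≡.sym len) ⟩
  k * suc (q + t) + r′                            ≡⟨ lemma r s q t r′ ⟩
  k * q + (r + (s + (k * t + r′)))                ∎)))
  where
  open ≡.≡-Reasoning
  k : ℕ
  k = r + s
  lemma : ∀ r s q t r′ → (r + s) * suc (q + t) + r′ ≡ (r + s) * q + (r + (s + ((r + s) * t + r′)))
  lemma = ℕ-solve-∀

-- If q < q′, the sums force r = r + s and r′ = 0: both lists consist of r copies of q′ = q + 1.
balanced-unique-< : ∀ {r s q r′ s′ q′} → q < q′ → r + s ≡ r′ + s′ →
                    r * suc q + s * q ≡ r′ * suc q′ + s′ * q′ → balanced r s q ≡ balanced r′ s′ q′
balanced-unique-< {r} {s} {q} {r′} {s′} q<q′ len sum≡ with m≤n⇒∃[o]m+o≡n q<q′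
... | t , ≡.refl with balanced-excess≡0 r s q t r′ s′ len sum≡
... | excess with m+n≡0⇒m≡0 s excess | m+n≡0⇒n≡0 ((r + s) * t) {r′} (m+n≡0⇒n≡0 s excess)
... | ≡.refl | ≡.refl = begin
  balanced r 0 q              ≡⟨ balanced-carry′ r t q rt≡0 ⟩
  balanced 0 r (suc (q + t))  ≡⟨ cong (λ s′ → balanced 0 s′ (suc (q + t))) r≡s′ ⟩
  balanced 0 s′ (suc (q + t)) ∎
  where
  open ≡.≡-Reasoning
  rt≡0 : r * t ≡ 0
  rt≡0 = ≡.subst (λ k → k * t ≡ 0) (+-identityʳ r) (m+n≡0⇒m≡0 ((r + 0) * t) (m+n≡0⇒n≡0 0 excess))
  r≡s′ : r ≡ s′
  r≡s′ = ≡.trans (≡.sym (+-identityʳ r)) len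

balanced-unique : ∀ {r s q r′ s′ q′} → r + s ≡ r′ + s′ →
                  r * suc q + s * q ≡ r′ * suc q′ + s′ * q′ → balanced r s q ≡ balanced r′ s′ q′
balanced-unique {r} {s} {q} {r′} {s′} {q′} len sum≡ with <-cmp q q′
... | tri< q<q′ _ _ = balanced-unique-< {r} {s} {q} {r′} {s′} q<q′ len sum≡
... | tri> _ _ q′<q = ≡.sym (balanced-unique-< {r′} {s′} {q′} {r} {s} q′<q (≡.sym len) (≡.sym sum≡))
... | tri≈ _ ≡.refl _ with +-cancelˡ-≡ ((r + s) * q) r r′ (begin
      (r + s) * q + r    ≡⟨ r*[1+q]+s*q≡[r+s]*q+r r s q ⟨
      r * suc q + s * q  ≡⟨ sum≡ ⟩
      r′ * suc q + s′ * q ≡⟨ r*[1+q]+s*q≡[r+s]*q+r r′ s′ q ⟩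
      (r′ + s′) * q + r′ ≡⟨ cong (λ k → k * q + r′) (≡.sym len) ⟩
      (r + s) * q + r′   ∎)
  where open ≡.≡-Reasoning
... | ≡.refl with +-cancelˡ-≡ r s s′ len
... | ≡.refl = ≡.refl

balanced-dominates : ∀ {xs r s q} → length xs ≡ r + s → List.sum xs ≡ r * suc q + s * q →
                     xs ≼ balanced r s q
balanced-dominates {xs} {r} {s} {q} len sum≡ with dominatedByBalanced xs
... | r′ , s′ , q′ , xs≼ =
  ≡.subst (xs ≼_) (balanced-unique {r′} {s′} {q′} {r} {s} {q} len′ sum′) xs≼
  where
  len′ : r′ + s′ ≡ r + s
  len′ = ≡.trans (≡.sym (length-balanced r′ s′ q′)) (≡.trans (≡.sym (length-≡ xs≼)) len)
  sum′ : r′ * suc q′ + s′ * q′ ≡ r * suc q + s * q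
  sum′ = ≡.trans (≡.sym (sum-balanced r′ s′ q′)) (≡.trans (≡.sym (sum-≡ xs≼)) sum≡)

All-positive⇒no-padding : ∀ xs p → List.All (0 <_) (xs ++ replicate p 0) → xs ++ replicate p 0 ≡ xs
All-positive⇒no-padding xs zero    _        = ++-identityʳ xs
All-positive⇒no-padding xs (suc p) positive with ++⁻ʳ xs positive
... | () List.∷ _

-- Padding with zeros changes no e_m and makes the lengths agree; in the equality case the
-- padding is empty because the balanced list has no zero entry.
balanced-maximal : ∀ {xs r s q} → 0 < q → length xs ≤ r + s → List.sum xs ≡ r * suc q + s * q →
                   (∀ m → e m xs ≤ e m (balanced r s q))
                   × (e 2 xs ≡ e 2 (balanced r s q) → xs ↭ balanced r s q)
balanced-maximal {xs} {r} {s} {q} q>0 len≤ sum≡ = e-bound , e₂-rigid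
  where
  p : ℕ
  p = r + s ∸ length xs
  padded-length : length (xs ++ replicate p 0) ≡ r + s
  padded-length = begin
    length (xs ++ replicate p 0)          ≡⟨ length-++ xs ⟩
    length xs + length (replicate p 0)    ≡⟨ cong (_+_ (length xs)) (length-replicate p) ⟩
    length xs + p                         ≡⟨ m+[n∸m]≡n len≤ ⟩
    r + s                                 ∎
    where open ≡.≡-Reasoning
  padded-sum : List.sum (xs ++ replicate p 0) ≡ r * suc q + s * q
  padded-sum = begin
    List.sum (xs ++ replicate p 0)              ≡⟨ sum-++ xs (replicate p 0) ⟩
    List.sum xs + List.sum (replicate p 0)      ≡⟨ cong (_+_ (List.sum xs)) (sum-replicate p 0) ⟩
    List.sum xs + p * 0                         ≡⟨ cong (_+_ (List.sum xs)) (*-zeroʳ p) ⟩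
    List.sum xs + 0                             ≡⟨ +-identityʳ (List.sum xs) ⟩
    List.sum xs                                 ≡⟨ sum≡ ⟩
    r * suc q + s * q                           ∎
    where open ≡.≡-Reasoning
  padded≼ : (xs ++ replicate p 0) ≼ balanced r s q
  padded≼ = balanced-dominates {r = r} {s} {q} padded-length padded-sum
  e-bound : ∀ m → e m xs ≤ e m (balanced r s q)
  e-bound m = ≡.subst (_≤ e m (balanced r s q)) (e-++-zeros xs p m) (e-≤ padded≼ m)
  e₂-rigid : e 2 xs ≡ e 2 (balanced r s q) → xs ↭ balanced r s q
  e₂-rigid e₂≡ with ↭⊎e₂< padded≼
  ... | inj₂ e₂< = contradiction (≡.trans (e-++-zeros xs p 2) e₂≡) (<⇒≢ e₂<)
  ... | inj₁ perm = ≡.subst (_↭ balanced r s q) (All-positive⇒no-padding xs p positive) perm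
    where
    positive : List.All (0 <_) (xs ++ replicate p 0)
    positive = All-resp-↭ (↭-sym perm) (++⁺ (replicate⁺ r (s≤s z≤n)) (replicate⁺ s q>0))

addHead-+ : ∀ a b P → addHead (a ℤ.+ b) P ≡ addHead a (addHead b P)
addHead-+ a b []      = ≡.refl
addHead-+ a b (c ∷ P) = cong (_∷ P) (ℤ.+-assoc a b c)

addHead₁ : ℤ → List ℤ → List ℤ
addHead₁ c []      = []
addHead₁ c (d ∷ P) = d ∷ addHead c P

mulLin-mulLin : ∀ a b c d ds →
  mulLin a (mulLin b (c ∷ d ∷ ds)) ≡
  - (a ℤ.* - (b ℤ.* c)) ∷ addHead (- (b ℤ.* c) ℤ.+ - (a ℤ.* c)) (addHead₁ c (mulLin a (mulLin b (d ∷ ds))))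
mulLin-mulLin a b c d ds =
  cong (- (a ℤ.* - (b ℤ.* c)) ∷_)
    (cong₂ _∷_ (lemma a b c d) (addHead-+ c (- (b ℤ.* d)) (mulLin a (addHead d (mulLin b ds)))))
  where
  lemma : ∀ a b c d → - (b ℤ.* c) ℤ.+ - (a ℤ.* (c ℤ.+ - (b ℤ.* d)))
                    ≡ (- (b ℤ.* c) ℤ.+ - (a ℤ.* c)) ℤ.+ - (a ℤ.* - (b ℤ.* d))
  lemma = solve-∀

-[a*-[b*c]]-comm : ∀ a b c → - (a ℤ.* - (b ℤ.* c)) ≡ - (b ℤ.* - (a ℤ.* c))
-[a*-[b*c]]-comm = solve-∀

mulLin-comm : ∀ a b P → mulLin a (mulLin b P) ≡ mulLin b (mulLin a P)
mulLin-comm a b []               = ≡.refl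
mulLin-comm a b (c ∷ [])         =
  cong₂ _∷_ (-[a*-[b*c]]-comm a b c) (cong (_∷ c ∷ []) (ℤ.+-comm (- (b ℤ.* c)) (- (a ℤ.* c))))
mulLin-comm a b (c ∷ d ∷ ds) = begin
  mulLin a (mulLin b (c ∷ d ∷ ds))
    ≡⟨ mulLin-mulLin a b c d ds ⟩
  - (a ℤ.* - (b ℤ.* c)) ∷ addHead (- (b ℤ.* c) ℤ.+ - (a ℤ.* c)) (addHead₁ c (mulLin a (mulLin b (d ∷ ds))))
    ≡⟨ cong₂ _∷_ (-[a*-[b*c]]-comm a b c)
         (cong₂ (λ h P → addHead h (addHead₁ c P)) (ℤ.+-comm (- (b ℤ.* c)) _) (mulLin-comm a b (d ∷ ds))) ⟩
  - (b ℤ.* - (a ℤ.* c)) ∷ addHead (- (a ℤ.* c) ℤ.+ - (b ℤ.* c)) (addHead₁ c (mulLin b (mulLin a (d ∷ ds))))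
    ≡⟨ mulLin-mulLin b a c d ds ⟨
  mulLin b (mulLin a (c ∷ d ∷ ds)) ∎
  where open ≡.≡-Reasoning

polyFromRoots-↭ : ∀ {xs ys} → xs ↭ ys → polyFromRoots xs ≡ polyFromRoots ys
polyFromRoots-↭ refl         = ≡.refl
polyFromRoots-↭ (prep x p)   = cong (mulLin (+ x)) (polyFromRoots-↭ p)
polyFromRoots-↭ (swap x y p) =
  ≡.trans (cong (λ P → mulLin (+ x) (mulLin (+ y) P)) (polyFromRoots-↭ p)) (mulLin-comm (+ x) (+ y) _)
polyFromRoots-↭ (trans p q)  = ≡.trans (polyFromRoots-↭ p) (polyFromRoots-↭ q)

mulLin-top : ∀ r cs a b c → ∃₂ λ d ds →
  mulLin r (cs ++ a ∷ b ∷ c ∷ []) ≡ d ∷ ds ++ a - r ℤ.* b ∷ b - r ℤ.* c ∷ c ∷ []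
mulLin-top r []       a b c = - (r ℤ.* a) , [] , ≡.refl
mulLin-top r (x ∷ cs) a b c with mulLin-top r cs a b c
... | d , ds , eq = - (r ℤ.* x) , x ℤ.+ d ∷ ds , cong (λ P → - (r ℤ.* x) ∷ addHead x P) eq

+e₂-∷ : ∀ x R → + e 2 R - + x ℤ.* - + e 1 R ≡ + e 2 (x ∷ R)
+e₂-∷ x R = ≡.trans (lemma (+ x) (+ e 1 R) (+ e 2 R))
              (≡.sym (≡.trans (ℤ.pos-+ (x * e 1 R) (e 2 R)) (cong (ℤ._+ + e 2 R) (ℤ.pos-* x (e 1 R)))))
  where
  lemma : ∀ x a b → b - x ℤ.* - a ≡ x ℤ.* a ℤ.+ b
  lemma = solve-∀

-e₁-∷ : ∀ x R → - + e 1 R - + x ℤ.* 1ℤ ≡ - + e 1 (x ∷ R)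
-e₁-∷ x R = ≡.trans (lemma (+ x) (+ e 1 R))
              (cong -_ (≡.sym (≡.trans (ℤ.pos-+ (x * 1) (e 1 R)) (cong (ℤ._+ + e 1 R) (ℤ.pos-* x 1)))))
  where
  lemma : ∀ x a → - a - x ℤ.* 1ℤ ≡ - (x ℤ.* 1ℤ ℤ.+ a)
  lemma = solve-∀

polyFromRoots-top : ∀ x y zs → ∃[ ds ]
  polyFromRoots (x ∷ y ∷ zs) ≡ ds ++ + e 2 (x ∷ y ∷ zs) ∷ - + e 1 (x ∷ y ∷ zs) ∷ 1ℤ ∷ []
polyFromRoots-top x y []       = [] , cong₂ _∷_ e₂≡ (cong₂ _∷_ e₁≡ ≡.refl)
  where
  e₂-pair : e 2 (x ∷ y ∷ []) ≡ x * y
  e₂-pair = lemma x y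
    where lemma : ∀ x y → x * (y * 1 + 0) + (y * 0 + 0) ≡ x * y
          lemma = ℕ-solve-∀
  e₁-pair : e 1 (x ∷ y ∷ []) ≡ x + y
  e₁-pair = lemma x y
    where lemma : ∀ x y → x * 1 + (y * 1 + 0) ≡ x + y
          lemma = ℕ-solve-∀
  e₂≡ : - (+ x ℤ.* - (+ y ℤ.* 1ℤ)) ≡ + e 2 (x ∷ y ∷ [])
  e₂≡ = ≡.trans (lemma (+ x) (+ y)) (≡.sym (≡.trans (cong +_ e₂-pair) (ℤ.pos-* x y)))
    where lemma : ∀ x y → - (x ℤ.* - (y ℤ.* 1ℤ)) ≡ x ℤ.* y
          lemma = solve-∀
  e₁≡ : - (+ y ℤ.* 1ℤ) ℤ.+ - (+ x ℤ.* 1ℤ) ≡ - + e 1 (x ∷ y ∷ [])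
  e₁≡ = ≡.trans (lemma (+ x) (+ y)) (cong -_ (≡.sym (≡.trans (cong +_ e₁-pair) (ℤ.pos-+ x y))))
    where lemma : ∀ x y → - (y ℤ.* 1ℤ) ℤ.+ - (x ℤ.* 1ℤ) ≡ - (x ℤ.+ y)
          lemma = solve-∀
polyFromRoots-top x y (z ∷ zs) with polyFromRoots-top y z zs
... | ds , eq with mulLin-top (+ x) ds (+ e 2 (y ∷ z ∷ zs)) (- + e 1 (y ∷ z ∷ zs)) 1ℤ
... | d , ds′ , eq′ = d ∷ ds′ , ≡.trans (cong (mulLin (+ x)) eq) (≡.trans eq′
        (cong (λ t → d ∷ ds′ ++ t)
          (cong₂ _∷_ (+e₂-∷ x (y ∷ z ∷ zs)) (cong₂ _∷_ (-e₁-∷ x (y ∷ z ∷ zs)) ≡.refl))))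

third-from-last : ∀ {A : Set} (ds ds′ : List A) {a b c a′ b′ c′} →
                  ds ++ a ∷ b ∷ c ∷ [] ≡ ds′ ++ a′ ∷ b′ ∷ c′ ∷ [] → a ≡ a′
third-from-last ds ds′ {a} {b} {c} {a′} {b′} {c′} eq =
  proj₁ (∷-injective (proj₂ (∷-injective (proj₂ (∷-injective reversed)))))
  where
  reversed : c ∷ b ∷ a ∷ reverse ds ≡ c′ ∷ b′ ∷ a′ ∷ reverse ds′
  reversed = ≡.trans (≡.sym (reverse-++ ds _)) (≡.trans (cong reverse eq) (reverse-++ ds′ _))

polyFromRoots-e₂ : ∀ {xs ys} → 2 ≤ length xs → 2 ≤ length ys →
                   polyFromRoots xs ≡ polyFromRoots ys → e 2 xs ≡ e 2 ys
polyFromRoots-e₂ {x ∷ x′ ∷ xs} {y ∷ y′ ∷ ys} _ _ eq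
  with polyFromRoots-top x x′ xs | polyFromRoots-top y y′ ys
... | ds , top | ds′ , top′ =
  ℤ.+-injective (third-from-last ds ds′ (≡.trans (≡.sym top) (≡.trans eq top′)))
polyFromRoots-e₂ {_ ∷ []}               (s≤s ()) _        _
polyFromRoots-e₂ {_ ∷ _ ∷ _} {_ ∷ []} _        (s≤s ()) _

balanced-extremal : ∀ {xs r s q} → 0 < q → 2 ≤ length xs → length xs ≤ r + s →
                    List.sum xs ≡ r * suc q + s * q →
                    (∀ m → e m xs ≤ e m (balanced r s q))
                    × ((e 2 xs ≡ e 2 (balanced r s q))
                       ⇔ (polyFromRoots xs ≡ polyFromRoots (balanced r s q)))
balanced-extremal {xs} {r} {s} {q} q>0 2≤xs len≤ sum≡ =
  proj₁ maximal ,
  mk⇔ (λ e₂≡ → polyFromRoots-↭ (proj₂ maximal e₂≡))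
      (polyFromRoots-e₂ {xs} {balanced r s q} 2≤xs 2≤balanced)
  where
  maximal : (∀ m → e m xs ≤ e m (balanced r s q))
            × (e 2 xs ≡ e 2 (balanced r s q) → xs ↭ balanced r s q)
  maximal = balanced-maximal {xs} {r} {s} {q} q>0 len≤ sum≡
  2≤balanced : 2 ≤ length (balanced r s q)
  2≤balanced = ≤-trans 2≤xs (≤-trans len≤ (≤-reflexive (≡.sym (length-balanced r s q))))

e₂-++ : ∀ xs ys → e 2 (xs ++ ys) ≡ e 2 xs + List.sum xs * List.sum ys + e 2 ys
e₂-++ []       ys = ≡.refl
e₂-++ (x ∷ xs) ys rewrite e₁≡sum (xs ++ ys) | sum-++ xs ys | e₂-++ xs ys | e₁≡sum xs =
  lemma x (List.sum xs) (List.sum ys) (e 2 xs) (e 2 ys)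
  where
  lemma : ∀ x a b c d → x * (a + b) + (c + a * b + d) ≡ x * a + c + (x + a) * b + d
  lemma = ℕ-solve-∀

e₂-replicate : ∀ a x → e 2 (replicate a x) ≡ (a C 2) * x ^ 2
e₂-replicate zero    x = ≡.refl
e₂-replicate (suc a) x rewrite e₁≡sum (replicate a x) | sum-replicate a x | e₂-replicate a x
  | ≡.sym (nCk+nC[k+1]≡[n+1]C[k+1] a 1) | nC1≡n a = lemma x a (a C 2)
  where
  lemma : ∀ x a c → x * (a * x) + c * (x * (x * 1)) ≡ (a + c) * (x * (x * 1))
  lemma = ℕ-solve-∀

e₂-replicate-++ : ∀ a b c f → e 2 (replicate a c ++ replicate b f)
                  ≡ (a C 2) * c ^ 2 + a * b * c * f + (b C 2) * f ^ 2
e₂-replicate-++ a b c f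
  rewrite e₂-++ (replicate a c) (replicate b f) | e₂-replicate a c | e₂-replicate b f
        | sum-replicate a c | sum-replicate b f =
  cong (λ t → (a C 2) * c ^ 2 + t + (b C 2) * f ^ 2) (lemma a b c f)
  where
  lemma : ∀ a b c f → a * c * (b * f) ≡ a * b * c * f
  lemma = ℕ-solve-∀

ceilDiv≡suc-floorDiv : ∀ n s .{{_ : NonZero n}} → ¬ (n ∣ s) → ceilDiv s n ≡ suc (floorDiv s n)
ceilDiv≡suc-floorDiv (suc k) s n∤s with s % suc k in rem
... | zero  = contradiction (m%n≡0⇒n∣m s (suc k) rem) n∤s
... | suc ρ = begin
  (s + k) / n            ≡⟨ cong (_/ n) s+k≡ ⟩
  (ρ + suc f * n) / n    ≡⟨ +-distrib-/-∣ʳ ρ (n∣m*n (suc f)) ⟩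
  ρ / n + suc f * n / n  ≡⟨ cong₂ _+_ (m<n⇒m/n≡0 ρ<n) (m*n/n≡m (suc f) n) ⟩
  suc f                  ∎
  where
  open ≡.≡-Reasoning
  n : ℕ
  n = suc k
  f : ℕ
  f = s / n
  ρ<n : ρ < n
  ρ<n = <-trans (n<1+n ρ) (≡.subst (_< n) rem (m%n<n s n))
  s+k≡ : s + k ≡ ρ + suc f * n
  s+k≡ = ≡.trans (cong (_+ k) (≡.trans (m≡m%n+[m/n]*n s n) (cong (_+ f * n) rem))) (lemma ρ f k)
    where
    lemma : ∀ ρ f k → suc ρ + f * suc k + k ≡ ρ + suc f * suc k
    lemma = ℕ-solve-∀

nonDivisor⇒2≤ : ∀ n s .{{_ : NonZero n}} → ¬ (n ∣ s) → 2 ≤ n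
nonDivisor⇒2≤ 1             s n∤s = contradiction (1∣ s) n∤s
nonDivisor⇒2≤ (suc (suc n)) s n∤s = s≤s (s≤s z≤n)

length≤sum : ∀ {n} {v : Vec ℕ n} → All (0 <_) v → n ≤ sum v
length≤sum []          = z≤n
length≤sum (x>0 ∷ v>0) = +-mono-≤ x>0 (length≤sum v>0)

sum-toList : ∀ {n} (v : Vec ℕ n) → List.sum (toList v) ≡ sum v
sum-toList []       = ≡.refl
sum-toList (x ∷ v) = cong (_+_ x) (sum-toList v)

lemma3p2 : (n : ℕ) .{{_ : NonZero n}} (λs : Vec ℕ n) →
    All (0 <_) λs →
    ¬ (n ∣ sum λs) →
    (δ : ℕ) → 0 < δ →
    sum λs ≡ (n ∸ δ) * ceilDiv (sum λs) n + δ * floorDiv (sum λs) n →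
    ((m : ℕ) → e m (toList λs)
        ≤ e m (extremal n δ (ceilDiv (sum λs) n) (floorDiv (sum λs) n)))
    × (e 2 (toList λs)
        ≤ ((n ∸ δ) C 2) * ceilDiv (sum λs) n ^ 2
          + (n ∸ δ) * δ * ceilDiv (sum λs) n * floorDiv (sum λs) n
          + (δ C 2) * floorDiv (sum λs) n ^ 2)
    × ((e 2 (toList λs)
        ≡ ((n ∸ δ) C 2) * ceilDiv (sum λs) n ^ 2
          + (n ∸ δ) * δ * ceilDiv (sum λs) n * floorDiv (sum λs) n
          + (δ C 2) * floorDiv (sum λs) n ^ 2)
       ⇔ (polyFromRoots (toList λs)
          ≡ polyFromRoots (extremal n δ (ceilDiv (sum λs) n) (floorDiv (sum λs) n))))
lemma3p2 n λs positive n∤S δ _ S≡ with ceilDiv (sum λs) n | ceilDiv≡suc-floorDiv n (sum λs) n∤S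
... | _ | ≡.refl =
  e-bound , ≡.subst (e 2 L ≤_) e₂-E (e-bound 2) , ≡.subst (λ t → (e 2 L ≡ t) ⇔ poly-equal) e₂-E e₂⇔poly
  where
  λ₋ : ℕ
  λ₋ = floorDiv (sum λs) n
  L : List ℕ
  L = toList λs
  E : List ℕ
  E = balanced (n ∸ δ) δ λ₋
  poly-equal : Set
  poly-equal = polyFromRoots L ≡ polyFromRoots E
  length-L : length L ≡ n
  length-L = length-toList λs
  extremality : (∀ m → e m L ≤ e m E) × ((e 2 L ≡ e 2 E) ⇔ poly-equal)
  extremality = balanced-extremal {L} {n ∸ δ} {δ} {λ₋}
    (m≥n⇒m/n>0 (length≤sum positive))
    (≡.subst (2 ≤_) (≡.sym length-L) (nonDivisor⇒2≤ n (sum λs) n∤S))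
    (≡.subst (_≤ (n ∸ δ) + δ) (≡.sym length-L)
      (≤-trans (m≤n+m∸n n δ) (≤-reflexive (+-comm δ (n ∸ δ)))))
    (≡.trans (sum-toList λs) S≡)
  e-bound : ∀ m → e m L ≤ e m E
  e-bound = proj₁ extremality
  e₂⇔poly : (e 2 L ≡ e 2 E) ⇔ poly-equal
  e₂⇔poly = proj₂ extremality
  e₂-E : e 2 E ≡ ((n ∸ δ) C 2) * suc λ₋ ^ 2 + (n ∸ δ) * δ * suc λ₋ * λ₋ + (δ C 2) * λ₋ ^ 2
  e₂-E = e₂-replicate-++ (n ∸ δ) δ (suc λ₋) λ₋
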